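{- Let $G$ be a finite simple graph and $k$ a positive integer. Every $T$-triangle in $\mathcal{B}_k(G)$ is either a cyclic $T$-triangle or a radial $T$-triangle.
   Context: A stable $k$-partition of $G$ is a multiset $P=\{V_1,\dots,V_k\}$ of $k$ independent sets of $G$ (some possibly empty) partitioning $V(G)$; $P-v$ denotes $\{V_i\setminus\{v\}\}$. The Bell $k$-coloring graph $\mathcal{B}_k(G)$ has vertex set the stable $k$-partitions, with distinct $P,Q$ adjacent iff $P-v=Q-v$ for some $v\in V(G)$; we write $P\sim_v Q$ and say $v$ realizes the edge. An $S$-clique is a clique admitting a single vertex $u$ with $P-u=P'-u$ for all members $P,P'$; a $T$-triangle is a $3$-clique that is not an $S$-clique. A cyclic $T$-triangle is a $3$-clique $\{P_1,P_2,P_3\}$ whose edges are realized by distinct vertices $v_1,v_2,v_3$ with $P_1\sim_{v_3}P_2$, $P_2\sim_{v_1}P_3$, $P_3\sim_{v_2}P_1$, such that $P_i$ contains $\{v_i\}$ as a singleton part for $i=1,2,3$. A radial $T$-triangle is a $3$-clique $\{P_1,P_2,P_3\}$ whose edges are realized by distinct $v_1,v_2,v_3$ in the same pattern, such that $P_1$ contains $\{v_1,v_2,v_3\}$ as a part. -}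

module Defs where

open import Data.Nat using (ℕ)
open import Data.Fin using (Fin)
open import Data.Product using (_×_; ∃; ∃-syntax)
open import Data.Sum using (_⊎_)
open import Relation.Nullary using (¬_)
open import Relation.Binary.PropositionalEquality using (_≡_; _≢_)

_⟺_ : Set → Set → Set
A ⟺ B = (A → B) × (B → A)
infix 3 _⟺_

record Graph (n : ℕ) : Set₁ where
  field
    Adj    : Fin n → Fin n → Set
    sym    : ∀ {x y} → Adj x y → Adj y x
    irrefl : ∀ {x} → ¬ Adj x x
open Graph public

-- A stable k-partition is represented by a labelling c : Fin n → Fin k whose
-- colour classes c⁻¹(i) (i : Fin k) are the k (possibly empty) parts.
-- Two labellings represent the same multiset of parts iff they induce the
-- same "same part" relation (see EqPart); all notions below depend only on
-- that relation, so this is a faithful encoding of the multiset P.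
Labelling : ℕ → ℕ → Set
Labelling n k = Fin n → Fin k

IsStable : ∀ {n k} → Graph n → Labelling n k → Set
IsStable G c = ∀ x y → Adj G x y → c x ≢ c y

EqPart : ∀ {n k} → Labelling n k → Labelling n k → Set
EqPart c d = ∀ x y → (c x ≡ c y ⟺ d x ≡ d y)

-- P - v = Q - v  (as multisets of k parts; since both have exactly k parts,
-- this is equality of the induced partitions of V(G) ∖ {v})
EqMinus : ∀ {n k} → Fin n → Labelling n k → Labelling n k → Set
EqMinus v c d = ∀ x y → x ≢ v → y ≢ v → (c x ≡ c y ⟺ d x ≡ d y)

Realizes : ∀ {n k} → Fin n → Labelling n k → Labelling n k → Set
Realizes v c d = ¬ EqPart c d × EqMinus v c d

Adjacent : ∀ {n k} → Labelling n k → Labelling n k → Set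
Adjacent {n} c d = ¬ EqPart c d × ∃[ v ] EqMinus v c d

Clique3 : ∀ {n k} → Graph n → Labelling n k → Labelling n k → Labelling n k → Set
Clique3 G p₁ p₂ p₃ =
  IsStable G p₁ × IsStable G p₂ × IsStable G p₃ ×
  Adjacent p₁ p₂ × Adjacent p₂ p₃ × Adjacent p₃ p₁

SClique3 : ∀ {n k} → Labelling n k → Labelling n k → Labelling n k → Set
SClique3 {n} p₁ p₂ p₃ =
  ∃[ u ] (EqMinus u p₁ p₂ × EqMinus u p₂ p₃ × EqMinus u p₃ p₁)

TTriangle : ∀ {n k} → Graph n → Labelling n k → Labelling n k → Labelling n k → Set
TTriangle G p₁ p₂ p₃ = Clique3 G p₁ p₂ p₃ × ¬ SClique3 p₁ p₂ p₃

SingletonPart : ∀ {n k} → Labelling n k → Fin n → Set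
SingletonPart c v = ∀ x → c x ≡ c v → x ≡ v

TriplePart : ∀ {n k} → Labelling n k → Fin n → Fin n → Fin n → Set
TriplePart c a b e = ∀ x → (c x ≡ c a ⟺ (x ≡ a ⊎ x ≡ b ⊎ x ≡ e))

Distinct3 : ∀ {n} → Fin n → Fin n → Fin n → Set
Distinct3 a b e = a ≢ b × b ≢ e × a ≢ e

Pattern : ∀ {n k} → Labelling n k → Labelling n k → Labelling n k →
          Fin n → Fin n → Fin n → Set
Pattern p₁ p₂ p₃ v₁ v₂ v₃ =
  Distinct3 v₁ v₂ v₃ ×
  Realizes v₃ p₁ p₂ × Realizes v₁ p₂ p₃ × Realizes v₂ p₃ p₁

CyclicOrd : ∀ {n k} → Labelling n k → Labelling n k → Labelling n k → Set
CyclicOrd {n} p₁ p₂ p₃ = ∃[ v₁ ] ∃[ v₂ ] ∃[ v₃ ]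
  (Pattern p₁ p₂ p₃ v₁ v₂ v₃ ×
   SingletonPart p₁ v₁ × SingletonPart p₂ v₂ × SingletonPart p₃ v₃)

RadialOrd : ∀ {n k} → Labelling n k → Labelling n k → Labelling n k → Set
RadialOrd {n} p₁ p₂ p₃ = ∃[ v₁ ] ∃[ v₂ ] ∃[ v₃ ]
  (Pattern p₁ p₂ p₃ v₁ v₂ v₃ × TriplePart p₁ v₁ v₂ v₃)

-- the triangle {P1,P2,P3} is unordered: the definition applies to some
-- labelling of its members as (P1,P2,P3)
SomeOrder : ∀ {n k} → (Labelling n k → Labelling n k → Labelling n k → Set) →
            Labelling n k → Labelling n k → Labelling n k → Set
SomeOrder R a b c =
  R a b c ⊎ R a c b ⊎ R b a c ⊎ R b c a ⊎ R c a b ⊎ R c b a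

CyclicTTriangle : ∀ {n k} → Graph n → Labelling n k → Labelling n k → Labelling n k → Set
CyclicTTriangle G a b c = TTriangle G a b c × SomeOrder CyclicOrd a b c

RadialTTriangle : ∀ {n k} → Graph n → Labelling n k → Labelling n k → Labelling n k → Set
RadialTTriangle G a b c = TTriangle G a b c × SomeOrder RadialOrd a b c

{-# OPTIONS --safe #-}
-- Name the edges P₁ ~_{v₃} P₂, P₂ ~_{v₁} P₃, P₃ ~_{v₂} P₁.  If two realizers
-- coincided, or if P₁ and P₂ agreed on whether v₃ and v₁ share a part, a single
-- vertex would realize all three edges and the triangle would be an S-clique.
-- So the realizers are distinct and each edge flips exactly one pair of
-- realizers (v₃v₁ for P₁P₂, and cyclically).  A vertex outside {v₁,v₂,v₃}
-- keeps its relations to them along every edge, hence v₁'s part in P₁ lies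
-- inside {v₁,v₂,v₃}.  Either some Pᵢ puts all three realizers in one part
-- (radial), or transitivity of "same part" and the three flips force every Pᵢ
-- to separate vᵢ from the other two (cyclic).
module Submission where

open import Defs hiding (sym)
open import Data.Nat using (ℕ; _≤_)
open import Data.Fin using (Fin)
open import Data.Fin.Properties using (_≟_)
open import Data.Product using (_×_; _,_; proj₁; proj₂; swap; uncurry)
open import Data.Sum as Sum using (_⊎_; inj₁; inj₂)
open import Data.Empty using (⊥-elim)
open import Function using (_∘_)
open import Relation.Nullary using (¬_; Dec; yes; no; contradiction)
open import Relation.Nullary.Decidable using (_×-dec_)
open import Relation.Binary.PropositionalEquality using (_≡_; _≢_; refl; sym; trans; ≢-sym)

private
  variable
    n k : ℕ
    A B C : Set
    P Q P₁ P₂ P₃ : Labelling n k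
    u w x y z v₁ v₂ v₃ : Fin n

⟺-sym : A ⟺ B → B ⟺ A
⟺-sym = swap

⟺-trans : A ⟺ B → B ⟺ C → A ⟺ C
⟺-trans (f , g) (h , i) = h ∘ f , g ∘ i

same-part-⟺-flip : (P x ≡ P y ⟺ Q x ≡ Q y) → (P y ≡ P x ⟺ Q y ≡ Q x)
same-part-⟺-flip (f , g) = sym ∘ f ∘ sym , sym ∘ g ∘ sym

same-part-⟺-rebase : P x ≡ P y → Q x ≡ Q y →
  (P x ≡ P z ⟺ Q x ≡ Q z) → (P z ≡ P y ⟺ Q z ≡ Q y)
same-part-⟺-rebase Px~y Qx~y (f , g) =
  (λ Pz~y → trans (sym (f (trans Px~y (sym Pz~y)))) Qx~y) ,
  (λ Qz~y → trans (sym (g (trans Qx~y (sym Qz~y)))) Px~y)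

EqMinus-sym : EqMinus u P Q → EqMinus u Q P
EqMinus-sym e x y x≢u y≢u = ⟺-sym (e x y x≢u y≢u)

EqMinus-trans : EqMinus u P₁ P₂ → EqMinus u P₂ P₃ → EqMinus u P₁ P₃
EqMinus-trans e f x y x≢u y≢u = ⟺-trans (e x y x≢u y≢u) (f x y x≢u y≢u)

EqMinus-move : EqMinus u P Q → (∀ y → y ≢ w → (P u ≡ P y ⟺ Q u ≡ Q y)) →
  EqMinus w P Q
EqMinus-move {u = u} {P = P} {Q = Q} e agree x y x≢w y≢w with x ≟ u | y ≟ u
... | yes refl | _        = agree y y≢w
... | no _     | yes refl = same-part-⟺-flip {P = P} {Q = Q} (agree x x≢w)
... | no x≢u   | no y≢u   = e x y x≢u y≢u

SClique3-rotate : SClique3 P₂ P₃ P₁ → SClique3 P₁ P₂ P₃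
SClique3-rotate (u , e₂₃ , e₃₁ , e₁₂) = u , e₁₂ , e₂₃ , e₃₁

realizers-distinct : ¬ SClique3 P₁ P₂ P₃ →
  EqMinus u P₁ P₂ → EqMinus w P₂ P₃ → u ≢ w
realizers-distinct nonS e₁₂ e₂₃ refl =
  nonS (_ , e₁₂ , e₂₃ , EqMinus-sym (EqMinus-trans e₁₂ e₂₃))

record Disagree (P Q : Labelling n k) (x y : Fin n) : Set where
  constructor disagree
  field ¬agree : ¬ (P x ≡ P y ⟺ Q x ≡ Q y)
open Disagree

Disagree-apart : Disagree P Q x y → P x ≢ P y → Q x ≡ Q y
Disagree-apart {Q = Q} {x = x} {y = y} d Px≁y with Q x ≟ Q y
... | yes Qx~y = Qx~y
... | no Qx≁y  = ⊥-elim (¬agree d ((λ Px~y → contradiction Px~y Px≁y) ,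
                                   (λ Qx~y → contradiction Qx~y Qx≁y)))

-- If P₁ and P₂ agreed on v₃v₁, then v₃'s relations would only change towards
-- v₂ (through P₃), so v₂ would realize all three edges.
realizer-pair-disagrees : ¬ SClique3 P₁ P₂ P₃ → v₃ ≢ v₁ → v₃ ≢ v₂ →
  EqMinus v₃ P₁ P₂ → EqMinus v₁ P₂ P₃ → EqMinus v₂ P₃ P₁ →
  Disagree P₁ P₂ v₃ v₁
realizer-pair-disagrees {P₁ = P₁} {P₂ = P₂} {P₃ = P₃} {v₃ = v₃} {v₁ = v₁} {v₂ = v₂}
  nonS v₃≢v₁ v₃≢v₂ e₁₂ e₂₃ e₃₁ = disagree (nonS ∘ agreement⇒SClique3)
  where
    agreement⇒SClique3 : (P₁ v₃ ≡ P₁ v₁ ⟺ P₂ v₃ ≡ P₂ v₁) → SClique3 P₁ P₂ P₃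
    agreement⇒SClique3 agree = v₂ , e₁₂′ , EqMinus-sym (EqMinus-trans e₃₁ e₁₂′) , e₃₁
      where
        agree-at-v₃ : ∀ y → y ≢ v₂ → (P₁ v₃ ≡ P₁ y ⟺ P₂ v₃ ≡ P₂ y)
        agree-at-v₃ y y≢v₂ with y ≟ v₁
        ... | yes refl = agree
        ... | no y≢v₁  = ⟺-sym (⟺-trans (e₂₃ v₃ y v₃≢v₁ y≢v₁) (e₃₁ v₃ y v₃≢v₂ y≢v₂))

        e₁₂′ : EqMinus v₂ P₁ P₂
        e₁₂′ = EqMinus-move e₁₂ agree-at-v₃

record Configuration (P₁ P₂ P₃ : Labelling n k) (v₁ v₂ v₃ : Fin n) : Set where
  field
    edge-pattern : Pattern P₁ P₂ P₃ v₁ v₂ v₃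
    disagree₁₂   : Disagree P₁ P₂ v₃ v₁
    disagree₂₃   : Disagree P₂ P₃ v₁ v₂
    disagree₃₁   : Disagree P₃ P₁ v₂ v₃

configuration : ¬ SClique3 P₁ P₂ P₃ →
  Realizes v₃ P₁ P₂ → Realizes v₁ P₂ P₃ → Realizes v₂ P₃ P₁ →
  Configuration P₁ P₂ P₃ v₁ v₂ v₃
configuration nonS r₁₂@(_ , e₁₂) r₂₃@(_ , e₂₃) r₃₁@(_ , e₃₁) = record
  { edge-pattern = (v₁≢v₂ , v₂≢v₃ , ≢-sym v₃≢v₁) , r₁₂ , r₂₃ , r₃₁
  ; disagree₁₂ = realizer-pair-disagrees nonS v₃≢v₁ (≢-sym v₂≢v₃) e₁₂ e₂₃ e₃₁
  ; disagree₂₃ = realizer-pair-disagrees nonS′ v₁≢v₂ (≢-sym v₃≢v₁) e₂₃ e₃₁ e₁₂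
  ; disagree₃₁ = realizer-pair-disagrees nonS″ v₂≢v₃ (≢-sym v₁≢v₂) e₃₁ e₁₂ e₂₃
  }
  where
    nonS′ = nonS ∘ SClique3-rotate
    nonS″ = nonS′ ∘ SClique3-rotate
    v₃≢v₁ = realizers-distinct nonS e₁₂ e₂₃
    v₁≢v₂ = realizers-distinct nonS′ e₂₃ e₃₁
    v₂≢v₃ = realizers-distinct nonS″ e₃₁ e₁₂

Pattern-rotate : Pattern P₁ P₂ P₃ v₁ v₂ v₃ → Pattern P₂ P₃ P₁ v₂ v₃ v₁
Pattern-rotate ((v₁≢v₂ , v₂≢v₃ , v₁≢v₃) , r₁₂ , r₂₃ , r₃₁) =
  (v₂≢v₃ , ≢-sym v₁≢v₃ , ≢-sym v₁≢v₂) , r₂₃ , r₃₁ , r₁₂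

rotate : Configuration P₁ P₂ P₃ v₁ v₂ v₃ → Configuration P₂ P₃ P₁ v₂ v₃ v₁
rotate C = record
  { edge-pattern = Pattern-rotate edge-pattern
  ; disagree₁₂ = disagree₂₃
  ; disagree₂₃ = disagree₃₁
  ; disagree₃₁ = disagree₁₂
  }
  where open Configuration C

Together3 : Labelling n k → Fin n → Fin n → Fin n → Set
Together3 P x y z = P x ≡ P y × P y ≡ P z

together3? : (P : Labelling n k) (x y z : Fin n) → Dec (Together3 P x y z)
together3? P x y z = (P x ≟ P y) ×-dec (P y ≟ P z)

module _ {P₁ P₂ P₃ : Labelling n k} {v₁ v₂ v₃ : Fin n}
         (C : Configuration P₁ P₂ P₃ v₁ v₂ v₃) where
  open Configuration C

  private
    v₁≢v₂ : v₁ ≢ v₂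
    v₁≢v₂ = proj₁ (proj₁ edge-pattern)
    v₂≢v₃ : v₂ ≢ v₃
    v₂≢v₃ = proj₁ (proj₂ (proj₁ edge-pattern))
    v₃≢v₁ : v₃ ≢ v₁
    v₃≢v₁ = ≢-sym (proj₂ (proj₂ (proj₁ edge-pattern)))
    e₁₂ : EqMinus v₃ P₁ P₂
    e₁₂ = proj₂ (proj₁ (proj₂ edge-pattern))
    e₂₃ : EqMinus v₁ P₂ P₃
    e₂₃ = proj₂ (proj₁ (proj₂ (proj₂ edge-pattern)))
    e₃₁ : EqMinus v₂ P₃ P₁
    e₃₁ = proj₂ (proj₂ (proj₂ (proj₂ edge-pattern)))

  -- A vertex x outside the realizers keeps its relation to v₁ from P₁ to P₂,
  -- and its relation to v₃ through P₃; sharing v₁'s part would then make P₁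
  -- and P₂ agree on v₃v₁.
  part-of-v₁⊆realizers : P₁ x ≡ P₁ v₁ → x ≡ v₁ ⊎ x ≡ v₂ ⊎ x ≡ v₃
  part-of-v₁⊆realizers {x = x} x~v₁ with x ≟ v₁ | x ≟ v₂ | x ≟ v₃
  ... | yes x≡v₁ | _        | _        = inj₁ x≡v₁
  ... | no _     | yes x≡v₂ | _        = inj₂ (inj₁ x≡v₂)
  ... | no _     | no _     | yes x≡v₃ = inj₂ (inj₂ x≡v₃)
  ... | no x≢v₁  | no x≢v₂  | no x≢v₃  =
    ⊥-elim (¬agree disagree₁₂ (same-part-⟺-rebase {P = P₁} {Q = P₂} x~v₁
      (proj₁ (e₁₂ x v₁ x≢v₃ (≢-sym v₃≢v₁)) x~v₁)
      (⟺-sym (⟺-trans (e₂₃ x v₃ x≢v₁ v₃≢v₁) (e₃₁ x v₃ x≢v₂ (≢-sym v₂≢v₃))))))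

  triple-part : Together3 P₁ v₁ v₂ v₃ → TriplePart P₁ v₁ v₂ v₃
  triple-part (v₁~v₂ , v₂~v₃) x = part-of-v₁⊆realizers , realizer-in-part
    where
      realizer-in-part : x ≡ v₁ ⊎ x ≡ v₂ ⊎ x ≡ v₃ → P₁ x ≡ P₁ v₁
      realizer-in-part (inj₁ refl)        = refl
      realizer-in-part (inj₂ (inj₁ refl)) = sym v₁~v₂
      realizer-in-part (inj₂ (inj₂ refl)) = sym (trans v₁~v₂ v₂~v₃)

  singleton-part : P₁ v₃ ≢ P₁ v₁ → P₁ v₁ ≢ P₁ v₂ → SingletonPart P₁ v₁
  singleton-part v₃≁v₁ v₁≁v₂ x x~v₁ with part-of-v₁⊆realizers x~v₁
  ... | inj₁ x≡v₁        = x≡v₁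
  ... | inj₂ (inj₁ refl) = contradiction (sym x~v₁) v₁≁v₂
  ... | inj₂ (inj₂ refl) = contradiction x~v₁ v₃≁v₁

  v₁-apart : ¬ Together3 P₁ v₁ v₂ v₃ → ¬ Together3 P₂ v₂ v₃ v₁ →
    ¬ Together3 P₃ v₃ v₁ v₂ → P₁ v₃ ≢ P₁ v₁ × P₁ v₁ ≢ P₁ v₂
  v₁-apart ¬T₁ ¬T₂ ¬T₃ = v₃≁v₁ , v₁≁v₂
    where
      v₃≁v₁ : P₁ v₃ ≢ P₁ v₁
      v₃≁v₁ v₃~v₁ with P₁ v₁ ≟ P₁ v₂
      ... | yes v₁~v₂ = ¬T₁ (v₁~v₂ , trans (sym v₁~v₂) (sym v₃~v₁))
      ... | no v₁≁v₂  = ¬T₃ (P₃v₃~v₁ , Disagree-apart disagree₂₃ P₂v₁≁v₂)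
        where
          P₃v₃~v₁ = proj₂ (e₃₁ v₃ v₁ (≢-sym v₂≢v₃) v₁≢v₂) v₃~v₁
          P₂v₁≁v₂ = v₁≁v₂ ∘ proj₂ (e₁₂ v₁ v₂ (≢-sym v₃≢v₁) v₂≢v₃)

      v₁≁v₂ : P₁ v₁ ≢ P₁ v₂
      v₁≁v₂ v₁~v₂ = ¬T₂ (trans (sym P₂v₁~v₂) (sym P₂v₃~v₁) , P₂v₃~v₁)
        where
          P₂v₁~v₂ = proj₁ (e₁₂ v₁ v₂ (≢-sym v₃≢v₁) v₂≢v₃) v₁~v₂
          P₂v₃~v₁ = Disagree-apart disagree₁₂ v₃≁v₁

  radial : Together3 P₁ v₁ v₂ v₃ → RadialOrd P₁ P₂ P₃
  radial T₁ = v₁ , v₂ , v₃ , edge-pattern , triple-part T₁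

  isolated : ¬ Together3 P₁ v₁ v₂ v₃ → ¬ Together3 P₂ v₂ v₃ v₁ →
    ¬ Together3 P₃ v₃ v₁ v₂ → SingletonPart P₁ v₁
  isolated ¬T₁ ¬T₂ ¬T₃ = uncurry singleton-part (v₁-apart ¬T₁ ¬T₂ ¬T₃)

cyclic⊎radial : Configuration P₁ P₂ P₃ v₁ v₂ v₃ →
  CyclicOrd P₁ P₂ P₃ ⊎ SomeOrder RadialOrd P₁ P₂ P₃
cyclic⊎radial {P₁ = P₁} {P₂ = P₂} {P₃ = P₃} {v₁ = v₁} {v₂ = v₂} {v₃ = v₃} C
  with together3? P₁ v₁ v₂ v₃ | together3? P₂ v₂ v₃ v₁ | together3? P₃ v₃ v₁ v₂
... | yes T₁ | _      | _      = inj₂ (inj₁ (radial C T₁))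
... | no _   | yes T₂ | _      = inj₂ (inj₂ (inj₂ (inj₂ (inj₁ (radial (rotate C) T₂)))))
... | no _   | no _   | yes T₃ = inj₂ (inj₂ (inj₂ (inj₂ (inj₂ (inj₁ (radial (rotate (rotate C)) T₃))))))
... | no ¬T₁ | no ¬T₂ | no ¬T₃ = inj₁ (v₁ , v₂ , v₃ , Configuration.edge-pattern C ,
  isolated C ¬T₁ ¬T₂ ¬T₃ ,
  isolated (rotate C) ¬T₂ ¬T₃ ¬T₁ ,
  isolated (rotate (rotate C)) ¬T₃ ¬T₁ ¬T₂)

lemma3p6 : (n k : ℕ) → 1 ≤ k → (G : Graph n) → (P₁ P₂ P₃ : Labelling n k) →
    TTriangle G P₁ P₂ P₃ →
    CyclicTTriangle G P₁ P₂ P₃ ⊎ RadialTTriangle G P₁ P₂ P₃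
lemma3p6 _ _ _ G P₁ P₂ P₃
  T@((_ , _ , _ , (P₁≉P₂ , _ , e₁₂) , (P₂≉P₃ , _ , e₂₃) , (P₃≉P₁ , _ , e₃₁)) , nonS) =
  Sum.map (λ cyc → T , inj₁ cyc) (T ,_)
    (cyclic⊎radial (configuration nonS (P₁≉P₂ , e₁₂) (P₂≉P₃ , e₂₃) (P₃≉P₁ , e₃₁)))
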